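{- Let $m\in\mathbb{Q}$ and $n\geq 2$, and let $f^{(n)}_m(X)$ and $r^{(n)}(X)$ be the polynomials defined in the context. If $\beta\in\mathbb{C}$ is a root of $f^{(n)}_m(X)$ and $\alpha\in\mathbb{C}$ is a root of $r^{(n)}(X)$, then $$\frac{\alpha\beta-1}{\beta+\alpha+1}$$ is also a root of $f^{(n)}_m(X)$.
   Context: For a rational number $m$ define $g,h:\mathbb{N}\to\mathbb{Q}$ by: $g(i)=1,\,-m,\,-m-1,\,-1,\,m,\,m+1$ according as $i\equiv 0,1,2,3,4,5 \pmod 6$, and $h(i)=0,\,-1,\,-1,\,0,\,1,\,1$ according as $i\equiv 0,1,2,3,4,5\pmod 6$. For $n\geq 0$ put $f^{(n)}_m(X)=\sum_{i=0}^{n}\binom{n}{i}X^i g(n-i)$ and $r^{(n)}(X)=\sum_{i=0}^{n}\binom{n}{i}X^i h(n-i)$. -}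

module Defs where

open import Level using (Level; 0ℓ; _⊔_)
open import Data.Nat using (ℕ; zero; suc; _∸_)
open import Data.Nat.Combinatorics using (_C_)
open import Data.Integer using (+_)
open import Data.Rational using (ℚ; _/_; 0ℚ; 1ℚ; -_) renaming (_+_ to _+ℚ_; _*_ to _*ℚ_)
open import Data.Rational.Properties using (+-*-ring)
open import Data.Product using (Σ; _×_)
open import Relation.Nullary using (¬_)
open import Algebra.Bundles using (CommutativeRing; Ring)
open import Algebra.Morphism.Structures using (module RingMorphisms)

ℕ→ℚ : ℕ → ℚ
ℕ→ℚ k = (+ k) / 1

g : ℚ → ℕ → ℚ
g m 0 = 1ℚ
g m 1 = - m
g m 2 = - m +ℚ - 1ℚ
g m 3 = - 1ℚ
g m 4 = m
g m 5 = m +ℚ 1ℚ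
g m (suc (suc (suc (suc (suc (suc i)))))) = g m i

h : ℕ → ℚ
h 0 = 0ℚ
h 1 = - 1ℚ
h 2 = - 1ℚ
h 3 = 0ℚ
h 4 = 1ℚ
h 5 = 1ℚ
h (suc (suc (suc (suc (suc (suc i)))))) = h i

-- coefficient of X^i in f^(n)_m and in r^(n)
fCoeff : ℚ → ℕ → ℕ → ℚ
fCoeff m n i = ℕ→ℚ (n C i) *ℚ g m (n ∸ i)

rCoeff : ℕ → ℕ → ℚ
rCoeff n i = ℕ→ℚ (n C i) *ℚ h (n ∸ i)

-- a field of characteristic 0: a commutative ring with 1 ≠ 0 in which every
-- nonzero element is invertible, together with a (unital) ring homomorphism ℚ → K
module _ {c ℓ : Level} (K : CommutativeRing c ℓ) where
  open CommutativeRing K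

  IsField : Set (c ⊔ ℓ)
  IsField = (¬ (1# ≈ 0#)) × (∀ x → ¬ (x ≈ 0#) → Σ Carrier λ y → x * y ≈ 1#)

  IsRingHomFromℚ : (ℚ → Carrier) → Set ℓ
  IsRingHomFromℚ ι = RingMorphisms.IsRingHomomorphism (Ring.rawRing +-*-ring) rawRing ι

  pow : Carrier → ℕ → Carrier
  pow x zero = 1#
  pow x (suc k) = x * pow x k

  evalUpTo : (ℚ → Carrier) → (ℕ → ℚ) → ℕ → Carrier → Carrier
  evalUpTo ι cf zero x = ι (cf 0)
  evalUpTo ι cf (suc k) x = evalUpTo ι cf k x + ι (cf (suc k)) * pow x (suc k)

  fEval : (ℚ → Carrier) → ℚ → ℕ → Carrier → Carrier
  fEval ι m n x = evalUpTo ι (fCoeff m n) n x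

  rEval : (ℚ → Carrier) → ℕ → Carrier → Carrier
  rEval ι n x = evalUpTo ι (rCoeff n) n x

-- Let ω be a root of X² − X + 1 (a primitive sixth root of unity) and put
-- L_u(a + bω) = a u₀ + b u₁. A sequence u with u_{j+2} = u_{j+1} − u_j satisfies
-- u_j = L_u(ωʲ); g and h are such sequences, so by the binomial theorem
-- f(x) = L_g((x + ω)ⁿ) and r(x) = L_h((x + ω)ⁿ) = −Im (x + ω)ⁿ.  Hence r(α) = 0 says
-- (α + ω)ⁿ = a is a scalar.  Since (α + ω)(β + ω) = D(γ + ω) with D = α + β + 1,
-- taking n-th powers and applying L_g gives Dⁿ f(γ) = a f(β) = 0.  If D = 0 then
-- β + ω = −conj(α + ω), so f(β) = (−1)ⁿ a forces a = 0; but α + ω is not nilpotent: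
-- its norm N and trace t would vanish, while 4N − t² = 3 ≠ 0.

module Submission where

open import Defs
open import Level using (Level)
open import Function using (_∘_)
open import Data.Product using (_×_; _,_; proj₁; proj₂)
open import Data.Maybe using (Maybe; just; nothing)
open import Relation.Nullary using (yes; no; ¬_)
import Relation.Binary.PropositionalEquality as ≡
import Relation.Binary.Reasoning.Setoid
open import Data.Nat using (ℕ; zero; suc; _∸_; _≥_)
import Data.Nat.Properties as ℕ
open import Data.Nat.Combinatorics using (_C_)
open import Data.Nat.Coprimality using (1-coprimeTo) renaming (sym to coprime-sym)
open import Data.Fin using (Fin; toℕ)
import Data.Fin as Fin
import Data.Fin.Properties as Fin
open import Data.Integer using (+_)
import Data.Integer.Properties as ℤ
open import Data.Rational using (ℚ; 1ℚ; 0ℚ; _/_) renaming (_+_ to _+ℚ_; _-_ to _-ℚ_; _*_ to _*ℚ_; -_ to -ℚ_)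
import Data.Rational.Properties as ℚ
open import Data.Rational.Solver using (module +-*-Solver)
open import Algebra.Bundles using (CommutativeRing; CommutativeSemiring; CommutativeMonoid; Ring)
open import Algebra.Structures.Biased using (isCommutativeSemiringˡ; isCommutativeMonoidˡ)
import Algebra.Construct.DirectProduct as DirectProduct
open import Algebra.Morphism.Structures using (module RingMorphisms)
open import Algebra.Solver.Ring.AlmostCommutativeRing using (fromCommutativeRing; _-Raw-AlmostCommutative⟶_)

ℕ→ℚ-suc : ∀ k → ℕ→ℚ (suc k) ≡.≡ 1ℚ +ℚ ℕ→ℚ k
ℕ→ℚ-suc k rewrite ℚ.normalize-coprime (coprime-sym (1-coprimeTo k)) | ℤ.*-identityʳ (+ k) = ≡.refl

Recurrentℚ : (ℕ → ℚ) → Set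
Recurrentℚ q = ∀ j → q (suc (suc j)) ≡.≡ q (suc j) -ℚ q j

module _ where
  open +-*-Solver

  g-recurrence : ∀ m → Recurrentℚ (g m)
  g-recurrence m 0 = ≡.refl
  g-recurrence m 1 = solve 1 (λ m → :- con 1ℚ := (:- m :+ :- con 1ℚ) :- (:- m)) ≡.refl m
  g-recurrence m 2 = solve 1 (λ m → m := :- con 1ℚ :- (:- m :+ :- con 1ℚ)) ≡.refl m
  g-recurrence m 3 = solve 1 (λ m → m :+ con 1ℚ := m :- (:- con 1ℚ)) ≡.refl m
  g-recurrence m 4 = solve 1 (λ m → con 1ℚ := (m :+ con 1ℚ) :- m) ≡.refl m
  g-recurrence m 5 = solve 1 (λ m → :- m := con 1ℚ :- (m :+ con 1ℚ)) ≡.refl m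
  g-recurrence m (suc (suc (suc (suc (suc (suc j)))))) = g-recurrence m j

  h-recurrence : Recurrentℚ h
  h-recurrence 0 = ≡.refl
  h-recurrence 1 = ≡.refl
  h-recurrence 2 = ≡.refl
  h-recurrence 3 = ≡.refl
  h-recurrence 4 = ≡.refl
  h-recurrence 5 = ≡.refl
  h-recurrence (suc (suc (suc (suc (suc (suc j)))))) = h-recurrence j

module ℚAlgebra {c ℓ : Level} (K : CommutativeRing c ℓ) (ι : ℚ → CommutativeRing.Carrier K) (ι-hom : IsRingHomFromℚ K ι) where
  open CommutativeRing K hiding (zero)
  open RingMorphisms.IsRingHomomorphism ι-hom

  ι-morphism : Ring.rawRing ℚ.+-*-ring -Raw-AlmostCommutative⟶ fromCommutativeRing K
  ι-morphism = record { ⟦_⟧ = ι ; +-homo = +-homo ; *-homo = *-homo ; -‿homo = -‿homo ; 0-homo = 0#-homo ; 1-homo = 1#-homo }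

  ι-≟ : ∀ p q → Maybe (ι p ≈ ι q)
  ι-≟ p q with p ℚ.≟ q
  ... | yes ≡.refl = just refl
  ... | no _       = nothing

  open import Algebra.Solver.Ring (Ring.rawRing ℚ.+-*-ring) (fromCommutativeRing K) ι-morphism ι-≟
  open import Relation.Binary.Reasoning.Setoid setoid

  ≈-+-≈0 : ∀ {x y e} → x ≈ y + e → e ≈ 0# → x ≈ y
  ≈-+-≈0 x≈y+e e≈0 = trans x≈y+e (trans (+-congˡ e≈0) (+-identityʳ _))

  Eis-+-commutativeMonoid : CommutativeMonoid c ℓ
  Eis-+-commutativeMonoid = DirectProduct.commutativeMonoid +-commutativeMonoid +-commutativeMonoid
  open CommutativeMonoid Eis-+-commutativeMonoid using ()
    renaming (Carrier to Eis; _≈_ to _≋_; _∙_ to infixl 6 _⊕_; ε to 0ᴱ; isEquivalence to ≋-isEquivalence)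

  re im : Eis → Carrier
  re = proj₁
  im = proj₂

  -- (a , b) stands for a + bω, where ω² = ω − 1.
  infixl 7 _⊛_
  _⊛_ : Eis → Eis → Eis
  (a , b) ⊛ (c , d) = (a * c - b * d , (a * d + b * c) + b * d)

  -- Constants are written as images under ι so that the ring solver, whose
  -- coefficients are rationals, can compute with them.
  ↑_ : Carrier → Eis
  ↑ a = (a , ι 0ℚ)

  1ᴱ ω : Eis
  1ᴱ = ↑ ι 1ℚ
  ω = (ι 0ℚ , ι 1ℚ)

  _+ω : Carrier → Eis
  x +ω = ↑ x ⊕ ω

  ⊛-cong : ∀ {z z′ w w′} → z ≋ z′ → w ≋ w′ → z ⊛ w ≋ z′ ⊛ w′
  ⊛-cong (a≈ , b≈) (c≈ , d≈) =
    +-cong (*-cong a≈ c≈) (-‿cong (*-cong b≈ d≈)) ,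
    +-cong (+-cong (*-cong a≈ d≈) (*-cong b≈ c≈)) (*-cong b≈ d≈)

  ⊛-assoc : ∀ z w v → (z ⊛ w) ⊛ v ≋ z ⊛ (w ⊛ v)
  ⊛-assoc (a , b) (c , d) (e , f) =
    solve 6 (λ a b c d e f → (a :* c :- b :* d) :* e :- ((a :* d :+ b :* c) :+ b :* d) :* f
                           := a :* (c :* e :- d :* f) :- b :* ((c :* f :+ d :* e) :+ d :* f)) refl a b c d e f ,
    solve 6 (λ a b c d e f → ((a :* c :- b :* d) :* f :+ ((a :* d :+ b :* c) :+ b :* d) :* e) :+ ((a :* d :+ b :* c) :+ b :* d) :* f
                           := (a :* ((c :* f :+ d :* e) :+ d :* f) :+ b :* (c :* e :- d :* f)) :+ b :* ((c :* f :+ d :* e) :+ d :* f)) refl a b c d e f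

  ⊛-comm : ∀ z w → z ⊛ w ≋ w ⊛ z
  ⊛-comm (a , b) (c , d) =
    solve 4 (λ a b c d → a :* c :- b :* d := c :* a :- d :* b) refl a b c d ,
    solve 4 (λ a b c d → (a :* d :+ b :* c) :+ b :* d := (c :* b :+ d :* a) :+ d :* b) refl a b c d

  ⊛-identityˡ : ∀ z → 1ᴱ ⊛ z ≋ z
  ⊛-identityˡ (a , b) =
    solve 2 (λ a b → con 1ℚ :* a :- con 0ℚ :* b := a) refl a b ,
    solve 2 (λ a b → (con 1ℚ :* b :+ con 0ℚ :* a) :+ con 0ℚ :* b := b) refl a b

  ⊛-distribʳ-⊕ : ∀ v z w → (z ⊕ w) ⊛ v ≋ z ⊛ v ⊕ w ⊛ v
  ⊛-distribʳ-⊕ (e , f) (a , b) (c , d) =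
    solve 6 (λ a b c d e f → (a :+ c) :* e :- (b :+ d) :* f := (a :* e :- b :* f) :+ (c :* e :- d :* f)) refl a b c d e f ,
    solve 6 (λ a b c d e f → ((a :+ c) :* f :+ (b :+ d) :* e) :+ (b :+ d) :* f
                           := ((a :* f :+ b :* e) :+ b :* f) :+ ((c :* f :+ d :* e) :+ d :* f)) refl a b c d e f

  ⊛-zeroˡ : ∀ z → 0ᴱ ⊛ z ≋ 0ᴱ
  ⊛-zeroˡ (a , b) =
    trans (+-cong (zeroˡ a) (-‿cong (zeroˡ b))) (-‿inverseʳ 0#) ,
    trans (+-cong (+-cong (zeroˡ b) (zeroˡ a)) (zeroˡ b)) (trans (+-identityʳ _) (+-identityʳ 0#))

  Eis-commutativeSemiring : CommutativeSemiring c ℓ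
  Eis-commutativeSemiring = record
    { isCommutativeSemiring = isCommutativeSemiringˡ record
      { +-isCommutativeMonoid = CommutativeMonoid.isCommutativeMonoid Eis-+-commutativeMonoid
      ; *-isCommutativeMonoid = isCommutativeMonoidˡ record
        { isSemigroup = record
          { isMagma = record { isEquivalence = ≋-isEquivalence ; ∙-cong = ⊛-cong }
          ; assoc = ⊛-assoc
          }
        ; identityˡ = ⊛-identityˡ
        ; comm = ⊛-comm
        }
      ; distribʳ = ⊛-distribʳ-⊕
      ; zeroˡ = ⊛-zeroˡ
      }
    }

  open CommutativeSemiring Eis-commutativeSemiring using ()
    renaming (refl to ≋-refl; sym to ≋-sym; trans to ≋-trans; setoid to Eis-setoid)
  module ≋ = Relation.Binary.Reasoning.Setoid Eis-setoid
  open import Algebra.Properties.CommutativeSemiring.Exp Eis-commutativeSemiring using (_^_; ^-congˡ; ^-distrib-*)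

  ι0-absorbs : ∀ s → s * ι 0ℚ ≈ ι 0ℚ
  ι0-absorbs s = solve 1 (λ s → s :* con 0ℚ := con 0ℚ) refl s

  ↑-⊛ : ∀ s z → ↑ s ⊛ z ≋ (s * re z , s * im z)
  ↑-⊛ s (a , b) =
    solve 3 (λ s a b → s :* a :- con 0ℚ :* b := s :* a) refl s a b ,
    solve 3 (λ s a b → (s :* b :+ con 0ℚ :* a) :+ con 0ℚ :* b := s :* b) refl s a b

  ↑-^ : ∀ s n → ↑ s ^ n ≋ ↑ pow K s n
  ↑-^ s zero    = 1#-homo , refl
  ↑-^ s (suc n) = ≋-trans (⊛-cong ≋-refl (↑-^ s n)) (≋-trans (↑-⊛ s _) (refl , ι0-absorbs s))

  conj : Eis → Eis
  conj (a , b) = (a + b , - b)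

  conj-cong : ∀ {z w} → z ≋ w → conj z ≋ conj w
  conj-cong (a≈ , b≈) = +-cong a≈ b≈ , -‿cong b≈

  conj-⊛ : ∀ z w → conj (z ⊛ w) ≋ conj z ⊛ conj w
  conj-⊛ (a , b) (c , d) =
    solve 4 (λ a b c d → (a :* c :- b :* d) :+ ((a :* d :+ b :* c) :+ b :* d) := (a :+ b) :* (c :+ d) :- (:- b) :* (:- d)) refl a b c d ,
    solve 4 (λ a b c d → :- ((a :* d :+ b :* c) :+ b :* d) := ((a :+ b) :* (:- d) :+ (:- b) :* (c :+ d)) :+ (:- b) :* (:- d)) refl a b c d

  conj-^ : ∀ z n → conj (z ^ n) ≋ conj z ^ n
  conj-^ z zero    = solve 0 (con 1ℚ :+ con 0ℚ := con 1ℚ) refl , solve 0 (:- con 0ℚ := con 0ℚ) refl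
  conj-^ z (suc n) = ≋-trans (conj-⊛ z (z ^ n)) (⊛-cong ≋-refl (conj-^ z n))

  conj-↑ : ∀ s → conj (↑ s) ≋ ↑ s
  conj-↑ s = solve 1 (λ s → s :+ con 0ℚ := s) refl s , solve 0 (:- con 0ℚ := con 0ℚ) refl

  norm trace : Eis → Carrier
  norm (a , b) = (a * a + a * b) + b * b
  trace (a , b) = (a + a) + b

  ⊛-conj : ∀ z → z ⊛ conj z ≋ ↑ norm z
  ⊛-conj (a , b) =
    solve 2 (λ a b → a :* (a :+ b) :- b :* (:- b) := (a :* a :+ a :* b) :+ b :* b) refl a b ,
    solve 2 (λ a b → (a :* (:- b) :+ b :* (a :+ b)) :+ b :* (:- b) := con 0ℚ) refl a b

  open import Algebra.Properties.Semiring.Sum semiring using (sum; sum-syntax; sum⁺-syntax; sum-cong-≋; sum-init-last)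
  open import Algebra.Properties.Monoid.Mult +-monoid using (×-congʳ) renaming (_×_ to _×ᴷ_)
  open import Algebra.Properties.Semiring.Sum (CommutativeSemiring.semiring Eis-commutativeSemiring) using ()
    renaming (sum to sumᴱ)
  open import Algebra.Properties.Semiring.Mult (CommutativeSemiring.semiring Eis-commutativeSemiring) using ()
    renaming (_×_ to _×ᴱ_)
  open import Algebra.Properties.CommutativeSemiring.Binomial Eis-commutativeSemiring
    using (binomialExpansion) renaming (theorem to binomial-theorem)

  form : (ℕ → Carrier) → Eis → Carrier
  form u (a , b) = a * u 0 + b * u 1

  Recurrent : (ℕ → Carrier) → Set ℓ
  Recurrent u = ∀ j → u (suc (suc j)) ≈ u (suc j) - u j

  module _ (u : ℕ → Carrier) where

    form-cong : ∀ {z w} → z ≋ w → form u z ≈ form u w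
    form-cong (a≈ , b≈) = +-cong (*-congʳ a≈) (*-congʳ b≈)

    form-0ᴱ : form u 0ᴱ ≈ 0#
    form-0ᴱ = trans (+-cong (zeroˡ (u 0)) (zeroˡ (u 1))) (+-identityʳ 0#)

    form-⊕ : ∀ z w → form u (z ⊕ w) ≈ form u z + form u w
    form-⊕ (a , b) (c , d) = solve 6 (λ a b c d u₀ u₁ → (a :+ c) :* u₀ :+ (b :+ d) :* u₁ := (a :* u₀ :+ b :* u₁) :+ (c :* u₀ :+ d :* u₁)) refl a b c d (u 0) (u 1)

    form-× : ∀ j z → form u (j ×ᴱ z) ≈ j ×ᴷ form u z
    form-× zero    z = form-0ᴱ
    form-× (suc j) z = trans (form-⊕ z (j ×ᴱ z)) (+-congˡ (form-× j z))

    form-sum : ∀ {n} (t : Fin n → Eis) → form u (sumᴱ t) ≈ sum (form u ∘ t)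
    form-sum {zero}  t = form-0ᴱ
    form-sum {suc n} t = trans (form-⊕ (t Fin.zero) _) (+-congˡ (form-sum (t ∘ Fin.suc)))

    form-↑⊛ : ∀ s z → form u (↑ s ⊛ z) ≈ s * form u z
    form-↑⊛ s z = trans (form-cong (↑-⊛ s z)) (solve 5 (λ s a b u₀ u₁ → (s :* a) :* u₀ :+ (s :* b) :* u₁ := s :* (a :* u₀ :+ b :* u₁)) refl s (re z) (im z) (u 0) (u 1))

  form-ω⊛ : ∀ {u} → Recurrent u → ∀ z → form u (ω ⊛ z) ≈ form (u ∘ suc) z
  form-ω⊛ {u} rec (a , b) = begin
      (ι 0ℚ * a - ι 1ℚ * b) * u 0 + ((ι 0ℚ * b + ι 1ℚ * a) + ι 1ℚ * b) * u 1
    ≈⟨ solve 5 (λ a b u₀ u₁ u₂ → (con 0ℚ :* a :- con 1ℚ :* b) :* u₀ :+ ((con 0ℚ :* b :+ con 1ℚ :* a) :+ con 1ℚ :* b) :* u₁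
                              := a :* u₁ :+ b :* (u₁ :- u₀)) refl a b (u 0) (u 1) (u 2) ⟩
      a * u 1 + b * (u 1 - u 0)
    ≈⟨ +-congˡ (*-congˡ (sym (rec 0))) ⟩
      a * u 1 + b * u 2
    ∎

  form-ω^ : ∀ {u} → Recurrent u → ∀ j → form u (ω ^ j) ≈ u j
  form-ω^ {u} rec zero    = solve 2 (λ u₀ u₁ → con 1ℚ :* u₀ :+ con 0ℚ :* u₁ := u₀) refl (u 0) (u 1)
  form-ω^ {u} rec (suc j) = trans (form-ω⊛ rec (ω ^ j)) (form-ω^ (rec ∘ suc) j)

  form-binomial : ∀ {u} → Recurrent u → ∀ x n →
    form u ((x +ω) ^ n) ≈ ∑[ k ≤ n ] ((n C toℕ k) ×ᴷ (pow K x (toℕ k) * u (n ∸ toℕ k)))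
  form-binomial {u} rec x n = begin
      form u ((x +ω) ^ n)
    ≈⟨ form-cong u (binomial-theorem n (↑ x) ω) ⟩
      form u (binomialExpansion (↑ x) ω n)
    ≈⟨ form-sum u {suc n} (λ k → (n C toℕ k) ×ᴱ (↑ x ^ toℕ k ⊛ ω ^ (n ∸ toℕ k))) ⟩
      ∑[ k ≤ n ] (form u ((n C toℕ k) ×ᴱ (↑ x ^ toℕ k ⊛ ω ^ (n ∸ toℕ k))))
    ≈⟨ sum-cong-≋ {suc n} (λ k → trans (form-× u (n C toℕ k) _) (×-congʳ (n C toℕ k) (term (toℕ k)))) ⟩
      ∑[ k ≤ n ] ((n C toℕ k) ×ᴷ (pow K x (toℕ k) * u (n ∸ toℕ k)))
    ∎
    where
    term : ∀ k → form u (↑ x ^ k ⊛ ω ^ (n ∸ k)) ≈ pow K x k * u (n ∸ k)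
    term k = trans (form-cong u (⊛-cong (↑-^ x k) ≋-refl)) (trans (form-↑⊛ u _ _) (*-congˡ (form-ω^ rec (n ∸ k))))

  ι-recurrent : ∀ {q} → Recurrentℚ q → Recurrent (ι ∘ q)
  ι-recurrent {q} rec j = trans (reflexive (≡.cong ι (rec j))) (trans (+-homo _ _) (+-congˡ (-‿homo _)))

  ι-ℕ→ℚ-* : ∀ j y → ι (ℕ→ℚ j) * y ≈ j ×ᴷ y
  ι-ℕ→ℚ-* zero    y = trans (*-congʳ 0#-homo) (zeroˡ y)
  ι-ℕ→ℚ-* (suc j) y = begin
      ι (ℕ→ℚ (suc j)) * y       ≈⟨ *-congʳ (trans (reflexive (≡.cong ι (ℕ→ℚ-suc j))) (+-homo _ _)) ⟩
      (ι 1ℚ + ι (ℕ→ℚ j)) * y    ≈⟨ solve 2 (λ n y → (con 1ℚ :+ n) :* y := y :+ n :* y) refl (ι (ℕ→ℚ j)) y ⟩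
      y + ι (ℕ→ℚ j) * y         ≈⟨ +-congˡ (ι-ℕ→ℚ-* j y) ⟩
      y + j ×ᴷ y                ∎

  evalUpTo-∑ : ∀ cf n x → evalUpTo K ι cf n x ≈ ∑[ k ≤ n ] (ι (cf (toℕ k)) * pow K x (toℕ k))
  evalUpTo-∑ cf zero    x = sym (trans (+-identityʳ _) (*-identityʳ _))
  evalUpTo-∑ cf (suc n) x = begin
      evalUpTo K ι cf n x + term (suc n)
    ≈⟨ +-cong (evalUpTo-∑ cf n x) (reflexive (≡.cong term (≡.sym (Fin.toℕ-fromℕ (suc n))))) ⟩
      ∑[ k ≤ n ] (term (toℕ k)) + term (toℕ (Fin.fromℕ (suc n)))
    ≈⟨ +-congʳ (sum-cong-≋ {suc n} λ k → reflexive (≡.cong term (≡.sym (Fin.toℕ-inject₁ k)))) ⟩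
      sum {suc n} (λ k → term (toℕ (Fin.inject₁ k))) + term (toℕ (Fin.fromℕ (suc n)))
    ≈⟨ sym (sum-init-last {suc n} (term ∘ toℕ)) ⟩
      ∑[ k ≤ suc n ] (term (toℕ k))
    ∎
    where
    term : ℕ → Carrier
    term k = ι (cf k) * pow K x k

  evalUpTo-binomial : ∀ {q} → Recurrentℚ q → ∀ n x →
    evalUpTo K ι (λ i → ℕ→ℚ (n C i) *ℚ q (n ∸ i)) n x ≈ form (ι ∘ q) ((x +ω) ^ n)
  evalUpTo-binomial {q} rec n x = begin
      evalUpTo K ι (λ i → ℕ→ℚ (n C i) *ℚ q (n ∸ i)) n x
    ≈⟨ evalUpTo-∑ _ n x ⟩
      ∑[ k ≤ n ] (ι (ℕ→ℚ (n C toℕ k) *ℚ q (n ∸ toℕ k)) * pow K x (toℕ k))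
    ≈⟨ sum-cong-≋ {suc n} (λ k → term (n C toℕ k) (q (n ∸ toℕ k)) (pow K x (toℕ k))) ⟩
      ∑[ k ≤ n ] ((n C toℕ k) ×ᴷ (pow K x (toℕ k) * ι (q (n ∸ toℕ k))))
    ≈⟨ sym (form-binomial (ι-recurrent {q} rec) x n) ⟩
      form (ι ∘ q) ((x +ω) ^ n)
    ∎
    where
    term : ∀ j r p → ι (ℕ→ℚ j *ℚ r) * p ≈ j ×ᴷ (p * ι r)
    term j r p = begin
      ι (ℕ→ℚ j *ℚ r) * p       ≈⟨ *-congʳ (*-homo _ _) ⟩
      (ι (ℕ→ℚ j) * ι r) * p    ≈⟨ solve 3 (λ a b p → (a :* b) :* p := a :* (p :* b)) refl _ _ _ ⟩
      ι (ℕ→ℚ j) * (p * ι r)    ≈⟨ ι-ℕ→ℚ-* j _ ⟩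
      j ×ᴷ (p * ι r)           ∎

  fEval-form : ∀ m n x → fEval K ι m n x ≈ form (ι ∘ g m) ((x +ω) ^ n)
  fEval-form m = evalUpTo-binomial {g m} (g-recurrence m)

  rEval-form : ∀ n x → rEval K ι n x ≈ form (ι ∘ h) ((x +ω) ^ n)
  rEval-form = evalUpTo-binomial {h} h-recurrence

  im≈0⇒≋↑re : ∀ {z} → im z ≈ 0# → z ≋ ↑ re z
  im≈0⇒≋↑re im≈0 = refl , trans im≈0 (sym 0#-homo)

  rEval≈0⇒im≈0 : ∀ n α → rEval K ι n α ≈ 0# → im ((α +ω) ^ n) ≈ 0#
  rEval≈0⇒im≈0 n α r≈0 = begin
      b                                    ≈⟨ solve 2 (λ a b → b := (a :* con 0ℚ :+ b :* con (-ℚ 1ℚ)) :* con (-ℚ 1ℚ)) refl a b ⟩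
      form (ι ∘ h) ((α +ω) ^ n) * ι (-ℚ 1ℚ) ≈⟨ *-congʳ (trans (sym (rEval-form n α)) r≈0) ⟩
      0# * ι (-ℚ 1ℚ)                       ≈⟨ zeroˡ _ ⟩
      0#                                   ∎
    where
    a b : Carrier
    a = re ((α +ω) ^ n)
    b = im ((α +ω) ^ n)

  form-g-↑ : ∀ m s → form (ι ∘ g m) (↑ s) ≈ s
  form-g-↑ m s = solve 2 (λ s μ → s :* con 1ℚ :+ con 0ℚ :* μ := s) refl s (ι (-ℚ m))

  +ω-⊛-+ω : ∀ {α β γ} → γ * ((β + α) + 1#) ≈ α * β - 1# → (α +ω) ⊛ (β +ω) ≋ ↑ ((β + α) + 1#) ⊛ (γ +ω)
  +ω-⊛-+ω {α} {β} {γ} hγ = re≈ , im≈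
    where
    D : Carrier
    D = (β + α) + 1#
    re≈ : (α + ι 0ℚ) * (β + ι 0ℚ) - (ι 0ℚ + ι 1ℚ) * (ι 0ℚ + ι 1ℚ) ≈ D * (γ + ι 0ℚ) - ι 0ℚ * (ι 0ℚ + ι 1ℚ)
    re≈ = begin
        (α + ι 0ℚ) * (β + ι 0ℚ) - (ι 0ℚ + ι 1ℚ) * (ι 0ℚ + ι 1ℚ)
      ≈⟨ solve 2 (λ α β → (α :+ con 0ℚ) :* (β :+ con 0ℚ) :- (con 0ℚ :+ con 1ℚ) :* (con 0ℚ :+ con 1ℚ) := α :* β :- con 1ℚ) refl α β ⟩
        α * β - ι 1ℚ
      ≈⟨ +-congˡ (-‿cong 1#-homo) ⟩
        α * β - 1#
      ≈⟨ sym hγ ⟩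
        γ * D
      ≈⟨ solve 2 (λ γ D → γ :* D := D :* (γ :+ con 0ℚ) :- con 0ℚ :* (con 0ℚ :+ con 1ℚ)) refl γ D ⟩
        D * (γ + ι 0ℚ) - ι 0ℚ * (ι 0ℚ + ι 1ℚ)
      ∎
    im≈ : ((α + ι 0ℚ) * (ι 0ℚ + ι 1ℚ) + (ι 0ℚ + ι 1ℚ) * (β + ι 0ℚ)) + (ι 0ℚ + ι 1ℚ) * (ι 0ℚ + ι 1ℚ)
        ≈ (D * (ι 0ℚ + ι 1ℚ) + ι 0ℚ * (γ + ι 0ℚ)) + ι 0ℚ * (ι 0ℚ + ι 1ℚ)
    im≈ = begin
        ((α + ι 0ℚ) * (ι 0ℚ + ι 1ℚ) + (ι 0ℚ + ι 1ℚ) * (β + ι 0ℚ)) + (ι 0ℚ + ι 1ℚ) * (ι 0ℚ + ι 1ℚ)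
      ≈⟨ solve 2 (λ α β → ((α :+ con 0ℚ) :* (con 0ℚ :+ con 1ℚ) :+ (con 0ℚ :+ con 1ℚ) :* (β :+ con 0ℚ)) :+ (con 0ℚ :+ con 1ℚ) :* (con 0ℚ :+ con 1ℚ)
                      := (β :+ α) :+ con 1ℚ) refl α β ⟩
        (β + α) + ι 1ℚ
      ≈⟨ +-congˡ 1#-homo ⟩
        D
      ≈⟨ solve 2 (λ γ D → D := (D :* (con 0ℚ :+ con 1ℚ) :+ con 0ℚ :* (γ :+ con 0ℚ)) :+ con 0ℚ :* (con 0ℚ :+ con 1ℚ)) refl γ D ⟩
        (D * (ι 0ℚ + ι 1ℚ) + ι 0ℚ * (γ + ι 0ℚ)) + ι 0ℚ * (ι 0ℚ + ι 1ℚ)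
      ∎

  fEval-image : ∀ m n {α β γ} → rEval K ι n α ≈ 0# → γ * ((β + α) + 1#) ≈ α * β - 1# →
    pow K ((β + α) + 1#) n * fEval K ι m n γ ≈ re ((α +ω) ^ n) * fEval K ι m n β
  fEval-image m n {α} {β} {γ} r≈0 hγ = begin
      pow K D n * fEval K ι m n γ         ≈⟨ *-congˡ (fEval-form m n γ) ⟩
      pow K D n * form u ((γ +ω) ^ n)     ≈⟨ sym (form-↑⊛ u (pow K D n) _) ⟩
      form u (↑ pow K D n ⊛ (γ +ω) ^ n)   ≈⟨ form-cong u powers ⟩
      form u (↑ a ⊛ (β +ω) ^ n)           ≈⟨ form-↑⊛ u a _ ⟩
      a * form u ((β +ω) ^ n)             ≈⟨ *-congˡ (sym (fEval-form m n β)) ⟩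
      a * fEval K ι m n β                 ∎
    where
    D a : Carrier
    D = (β + α) + 1#
    a = re ((α +ω) ^ n)
    u : ℕ → Carrier
    u = ι ∘ g m
    powers : ↑ pow K D n ⊛ (γ +ω) ^ n ≋ ↑ a ⊛ (β +ω) ^ n
    powers = ≋.begin
      ↑ pow K D n ⊛ (γ +ω) ^ n   ≋.≈⟨ ⊛-cong (≋-sym (↑-^ D n)) ≋-refl ⟩
      ↑ D ^ n ⊛ (γ +ω) ^ n       ≋.≈⟨ ≋-sym (^-distrib-* (↑ D) (γ +ω) n) ⟩
      (↑ D ⊛ (γ +ω)) ^ n         ≋.≈⟨ ^-congˡ n (≋-sym (+ω-⊛-+ω hγ)) ⟩
      ((α +ω) ⊛ (β +ω)) ^ n      ≋.≈⟨ ^-distrib-* (α +ω) (β +ω) n ⟩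
      (α +ω) ^ n ⊛ (β +ω) ^ n    ≋.≈⟨ ⊛-cong (im≈0⇒≋↑re (rEval≈0⇒im≈0 n α r≈0)) ≋-refl ⟩
      ↑ a ⊛ (β +ω) ^ n           ≋.∎

  +ω-reflection : ∀ {α β} → (β + α) + 1# ≈ 0# → β +ω ≋ ↑ ι (-ℚ 1ℚ) ⊛ conj (α +ω)
  +ω-reflection {α} {β} D≈0 = re≈ , im≈
    where
    re≈ : β + ι 0ℚ ≈ ι (-ℚ 1ℚ) * ((α + ι 0ℚ) + (ι 0ℚ + ι 1ℚ)) - ι 0ℚ * (- (ι 0ℚ + ι 1ℚ))
    re≈ = ≈-+-≈0
      (solve 2 (λ α β → β :+ con 0ℚ := (con (-ℚ 1ℚ) :* ((α :+ con 0ℚ) :+ (con 0ℚ :+ con 1ℚ)) :- con 0ℚ :* (:- (con 0ℚ :+ con 1ℚ))) :+ ((β :+ α) :+ con 1ℚ)) refl α β)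
      (trans (+-congˡ 1#-homo) D≈0)
    im≈ : ι 0ℚ + ι 1ℚ ≈ (ι (-ℚ 1ℚ) * (- (ι 0ℚ + ι 1ℚ)) + ι 0ℚ * ((α + ι 0ℚ) + (ι 0ℚ + ι 1ℚ))) + ι 0ℚ * (- (ι 0ℚ + ι 1ℚ))
    im≈ = solve 1 (λ α → con 0ℚ :+ con 1ℚ := (con (-ℚ 1ℚ) :* (:- (con 0ℚ :+ con 1ℚ)) :+ con 0ℚ :* ((α :+ con 0ℚ) :+ (con 0ℚ :+ con 1ℚ))) :+ con 0ℚ :* (:- (con 0ℚ :+ con 1ℚ))) refl α

  fEval-reflection : ∀ m n {α β} → rEval K ι n α ≈ 0# → (β + α) + 1# ≈ 0# →
    fEval K ι m n β ≈ pow K (ι (-ℚ 1ℚ)) n * re ((α +ω) ^ n)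
  fEval-reflection m n {α} {β} r≈0 D≈0 = begin
      fEval K ι m n β                ≈⟨ fEval-form m n β ⟩
      form u ((β +ω) ^ n)            ≈⟨ form-cong u powers ⟩
      form u (↑ sign ⊛ ↑ a)          ≈⟨ form-↑⊛ u sign (↑ a) ⟩
      sign * form u (↑ a)            ≈⟨ *-congˡ (form-g-↑ m a) ⟩
      sign * a                       ∎
    where
    u : ℕ → Carrier
    u = ι ∘ g m
    a sign : Carrier
    a = re ((α +ω) ^ n)
    sign = pow K (ι (-ℚ 1ℚ)) n
    powers : (β +ω) ^ n ≋ ↑ sign ⊛ ↑ a
    powers = ≋.begin
      (β +ω) ^ n                               ≋.≈⟨ ^-congˡ n (+ω-reflection D≈0) ⟩
      (↑ ι (-ℚ 1ℚ) ⊛ conj (α +ω)) ^ n          ≋.≈⟨ ^-distrib-* (↑ ι (-ℚ 1ℚ)) (conj (α +ω)) n ⟩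
      ↑ ι (-ℚ 1ℚ) ^ n ⊛ conj (α +ω) ^ n        ≋.≈⟨ ⊛-cong (↑-^ (ι (-ℚ 1ℚ)) n) (≋-sym (conj-^ (α +ω) n)) ⟩
      ↑ sign ⊛ conj ((α +ω) ^ n)               ≋.≈⟨ ⊛-cong ≋-refl (conj-cong (im≈0⇒≋↑re (rEval≈0⇒im≈0 n α r≈0))) ⟩
      ↑ sign ⊛ conj (↑ a)                      ≋.≈⟨ ⊛-cong ≋-refl (conj-↑ a) ⟩
      ↑ sign ⊛ ↑ a                             ≋.∎

  norm≈0⇒^-suc : ∀ z → norm z ≈ 0# → ∀ k → z ^ suc k ≋ (pow K (trace z) k * re z , pow K (trace z) k * im z)
  norm≈0⇒^-suc (a , b) N≈0 zero =
    trans (solve 2 (λ a b → a :* con 1ℚ :- b :* con 0ℚ := con 1ℚ :* a) refl a b) (*-congʳ 1#-homo) ,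
    trans (solve 2 (λ a b → (a :* con 0ℚ :+ b :* con 1ℚ) :+ b :* con 0ℚ := con 1ℚ :* b) refl a b) (*-congʳ 1#-homo)
  norm≈0⇒^-suc (a , b) N≈0 (suc k) = ≋-trans (⊛-cong ≋-refl (norm≈0⇒^-suc (a , b) N≈0 k)) (re≈ , im≈)
    where
    t p : Carrier
    t = (a + a) + b
    p = pow K t k
    re≈ : a * (p * a) - b * (p * b) ≈ (t * p) * a
    re≈ = ≈-+-≈0
      (solve 3 (λ a b p → a :* (p :* a) :- b :* (p :* b) := ((a :+ a) :+ b) :* p :* a :+ con (-ℚ 1ℚ) :* (p :* ((a :* a :+ a :* b) :+ b :* b))) refl a b p)
      (trans (*-congˡ (trans (*-congˡ N≈0) (zeroʳ p))) (zeroʳ _))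
    im≈ : (a * (p * b) + b * (p * a)) + b * (p * b) ≈ (t * p) * b
    im≈ = solve 3 (λ a b p → (a :* (p :* b) :+ b :* (p :* a)) :+ b :* (p :* b) := ((a :+ a) :+ b) :* p :* b) refl a b p

  module _ (isField : IsField K) where

    *-cancelˡ-≈0 : ∀ {x y} → ¬ (x ≈ 0#) → x * y ≈ 0# → y ≈ 0#
    *-cancelˡ-≈0 {x} {y} x≉0 xy≈0 with proj₂ isField x x≉0
    ... | x⁻¹ , xx⁻¹≈1 = begin
      y                ≈⟨ sym (*-identityˡ y) ⟩
      1# * y           ≈⟨ *-congʳ (sym xx⁻¹≈1) ⟩
      (x * x⁻¹) * y    ≈⟨ solve 3 (λ x x⁻¹ y → (x :* x⁻¹) :* y := x⁻¹ :* (x :* y)) refl x x⁻¹ y ⟩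
      x⁻¹ * (x * y)    ≈⟨ *-congˡ xy≈0 ⟩
      x⁻¹ * 0#         ≈⟨ zeroʳ x⁻¹ ⟩
      0#               ∎

    *-≉0 : ∀ {x y} → ¬ (x ≈ 0#) → ¬ (y ≈ 0#) → ¬ (x * y ≈ 0#)
    *-≉0 x≉0 y≉0 xy≈0 = y≉0 (*-cancelˡ-≈0 x≉0 xy≈0)

    pow-≉0 : ∀ {x} → ¬ (x ≈ 0#) → ∀ n → ¬ (pow K x n ≈ 0#)
    pow-≉0 x≉0 zero    = proj₁ isField
    pow-≉0 x≉0 (suc n) = *-≉0 x≉0 (pow-≉0 x≉0 n)

    ι-≉0 : ∀ p q → p *ℚ q ≡.≡ 1ℚ → ¬ (ι p ≈ 0#)
    ι-≉0 p q pq≡1 ιp≈0 = proj₁ isField (begin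
      1#            ≈⟨ sym 1#-homo ⟩
      ι 1ℚ          ≈⟨ reflexive (≡.cong ι (≡.sym pq≡1)) ⟩
      ι (p *ℚ q)    ≈⟨ *-homo p q ⟩
      ι p * ι q     ≈⟨ *-congʳ ιp≈0 ⟩
      0# * ι q      ≈⟨ zeroˡ _ ⟩
      0#            ∎)

    im≉0⇒¬nilpotent : ∀ z k → ¬ (im z ≈ 0#) → ¬ (z ^ suc k ≋ 0ᴱ)
    im≉0⇒¬nilpotent z@(a , b) k b≉0 zᵏ⁺¹≈0 = ¬¬norm≈0 λ N≈0 → ¬¬trace≈0 N≈0 λ t≈0 → 3b²≉0 (3b²≈0 N≈0 t≈0)
      where
      norm-power≈0 : ↑ pow K (norm z) (suc k) ≋ 0ᴱ
      norm-power≈0 = ≋.begin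
        ↑ pow K (norm z) (suc k)     ≋.≈⟨ ≋-sym (↑-^ (norm z) (suc k)) ⟩
        ↑ norm z ^ suc k             ≋.≈⟨ ^-congˡ (suc k) (≋-sym (⊛-conj z)) ⟩
        (z ⊛ conj z) ^ suc k         ≋.≈⟨ ^-distrib-* z (conj z) (suc k) ⟩
        z ^ suc k ⊛ conj z ^ suc k   ≋.≈⟨ ⊛-cong zᵏ⁺¹≈0 ≋-refl ⟩
        0ᴱ ⊛ conj z ^ suc k          ≋.≈⟨ ⊛-zeroˡ _ ⟩
        0ᴱ                           ≋.∎
      ¬¬norm≈0 : ¬ ¬ (norm z ≈ 0#)
      ¬¬norm≈0 N≉0 = pow-≉0 N≉0 (suc k) (proj₁ norm-power≈0)
      ¬¬trace≈0 : norm z ≈ 0# → ¬ ¬ (trace z ≈ 0#)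
      ¬¬trace≈0 N≈0 t≉0 = *-≉0 (pow-≉0 t≉0 k) b≉0 (trans (sym (proj₂ (norm≈0⇒^-suc z N≈0 k))) (proj₂ zᵏ⁺¹≈0))
      3b²≈0 : norm z ≈ 0# → trace z ≈ 0# → ι (ℕ→ℚ 3) * (b * b) ≈ 0#
      3b²≈0 N≈0 t≈0 = begin
        ι (ℕ→ℚ 3) * (b * b)
          ≈⟨ solve 2 (λ a b → con (ℕ→ℚ 3) :* (b :* b) := con (ℕ→ℚ 4) :* ((a :* a :+ a :* b) :+ b :* b) :- ((a :+ a) :+ b) :* ((a :+ a) :+ b)) refl a b ⟩
        ι (ℕ→ℚ 4) * norm z - trace z * trace z
          ≈⟨ +-cong (trans (*-congˡ N≈0) (zeroʳ _)) (-‿cong (trans (*-congʳ t≈0) (zeroˡ _))) ⟩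
        0# - 0#
          ≈⟨ -‿inverseʳ 0# ⟩
        0# ∎
      3b²≉0 : ¬ (ι (ℕ→ℚ 3) * (b * b) ≈ 0#)
      3b²≉0 = *-≉0 (ι-≉0 (ℕ→ℚ 3) ((+ 1) / 3) ≡.refl) (*-≉0 b≉0 b≉0)

    fEval-image-root : ∀ m n {α β γ} → fEval K ι m n β ≈ 0# → rEval K ι n α ≈ 0# →
      ¬ ((β + α) + 1# ≈ 0#) → γ * ((β + α) + 1#) ≈ α * β - 1# → fEval K ι m n γ ≈ 0#
    fEval-image-root m n f≈0 r≈0 D≉0 hγ =
      *-cancelˡ-≈0 (pow-≉0 D≉0 n) (trans (fEval-image m n r≈0 hγ) (trans (*-congˡ f≈0) (zeroʳ _)))

    denominator-≉0 : ∀ m n {α β} → n ≥ 1 → fEval K ι m n β ≈ 0# → rEval K ι n α ≈ 0# → ¬ ((β + α) + 1# ≈ 0#)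
    denominator-≉0 m zero ()
    denominator-≉0 m (suc k) {α} _ f≈0 r≈0 D≈0 = im≉0⇒¬nilpotent (α +ω) k ω-part≉0 (a≈0 , rEval≈0⇒im≈0 (suc k) α r≈0)
      where
      a≈0 : re ((α +ω) ^ suc k) ≈ 0#
      a≈0 = *-cancelˡ-≈0 (pow-≉0 (ι-≉0 (-ℚ 1ℚ) (-ℚ 1ℚ) ≡.refl) (suc k)) (trans (sym (fEval-reflection m (suc k) r≈0 D≈0)) f≈0)
      ω-part≉0 : ¬ (ι 0ℚ + ι 1ℚ ≈ 0#)
      ω-part≉0 = ι-≉0 1ℚ 1ℚ ≡.refl ∘ trans (solve 0 (con 1ℚ := con 0ℚ :+ con 1ℚ) refl)

mainTheorem4 : {c ℓ : Level} (K : CommutativeRing c ℓ) → IsField K →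
    (ι : ℚ → CommutativeRing.Carrier K) → IsRingHomFromℚ K ι →
    (m : ℚ) (n : ℕ) → n ≥ 2 →
    (α β : CommutativeRing.Carrier K) →
    CommutativeRing._≈_ K (fEval K ι m n β) (CommutativeRing.0# K) →
    CommutativeRing._≈_ K (rEval K ι n α) (CommutativeRing.0# K) →
    let open CommutativeRing K in
      (¬ ((β + α) + 1# ≈ 0#)) ×
      (∀ γ → γ * ((β + α) + 1#) ≈ (α * β) - 1# → fEval K ι m n γ ≈ 0#)
mainTheorem4 K isField ι ι-hom m n n≥2 α β f≈0 r≈0 = D≉0 , λ γ → fEval-image-root isField m n f≈0 r≈0 D≉0
  where
  open CommutativeRing K using (_+_; _≈_; 0#; 1#)
  open ℚAlgebra K ι ι-hom
  D≉0 : ¬ ((β + α) + 1# ≈ 0#)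
  D≉0 = denominator-≉0 isField m n (ℕ.≤-trans (ℕ.n≤1+n 1) n≥2) f≈0 r≈0
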